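{- For every integer $q\ge 6$ there exists a good $\mathcal{SOS}_q(2)$ of period \begin{align*} \tfrac{(q-2)(q-4)}{2} &\quad\text{if } q\equiv 0 \pmod 4,\\ \tfrac{(q-3)(q-5)}{2} &\quad\text{if } q\equiv 1 \pmod 4,\\ \tfrac{(q-2)(q-6)}{2} &\quad\text{if } q\equiv 2 \pmod 4,\\ \tfrac{(q-3)(q-7)}{2} &\quad\text{if } q\equiv 3 \pmod 4. \end{align*}
   Context: Sequences are periodic with entries in $\mathbb{Z}_q$, period $m$. Write $\mathbf{s}_n(i)=(s_i,\ldots,s_{i+n-1})$; $\mathbf{u}^R$ denotes the reverse and $-\mathbf{u}$ the entrywise negative of a tuple $\mathbf{u}$. An $\mathcal{SOS}_q(n)$ is a periodic sequence such that $\mathbf{s}_n(i)=\mathbf{s}_n(j)$ implies $i\equiv j\pmod m$, and for all $i,j$: $\mathbf{s}_n(i)\neq\mathbf{s}_n(j)^R$ and $\mathbf{s}_n(i)\neq-\mathbf{s}_n(j)^R$. It is good if every run of consecutive $0$s has length at most $n-2$ (so for $n=2$, a good sequence contains no $0$). -}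

module Defs where

open import Data.Nat using (ℕ; zero; suc; _+_; _*_; _∸_)
open import Data.Nat.DivMod using (_mod_; _%_; _/_)
open import Data.Fin using (Fin; zero; suc; toℕ; inject₁; opposite)
open import Data.Vec using (Vec; tabulate; reverse; map)
open import Data.Product using (_×_)
open import Relation.Nullary using (¬_)
open import Relation.Binary.PropositionalEquality using (_≡_; _≢_)

negℤ : ∀ {q} → Fin q → Fin q
negℤ zero = zero
negℤ (suc i) = opposite (inject₁ i)     -- q - (i+1)

-- A periodic sequence of period m is given by one period  s : Fin m → A;
-- the entry s_{i+k} (indices modulo m).
at : ∀ {m} {A : Set} → (Fin m → A) → Fin m → ℕ → A
at {suc m} s i k = s ((toℕ i + k) mod suc m)

window : ∀ {m} {A : Set} (n : ℕ) → (Fin m → A) → Fin m → Vec A n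
window n s i = tabulate (λ (k : Fin n) → at s i (toℕ k))

IsSOS : ∀ {m} (q n : ℕ) → (Fin m → Fin q) → Set
IsSOS q n s =
  (∀ i j → window n s i ≡ window n s j → i ≡ j) ×
  (∀ i j → window n s i ≢ reverse (window n s j)) ×
  (∀ i j → window n s i ≢ map negℤ (reverse (window n s j)))

-- good: every run of consecutive 0s has length at most n-2, i.e. no
-- (cyclic) block of n-1 consecutive entries is entirely 0.
IsGood : ∀ {m} (q n : ℕ) → (Fin m → Fin q) → Set
IsGood {m} q n s = ∀ (i : Fin m) → ¬ (∀ (k : Fin (n ∸ 1)) → toℕ (at s i (toℕ k)) ≡ 0)

sosPeriod : ℕ → ℕ
sosPeriod q with q % 4
... | 0 = ((q ∸ 2) * (q ∸ 4)) / 2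
... | 1 = ((q ∸ 3) * (q ∸ 5)) / 2
... | 2 = ((q ∸ 2) * (q ∸ 6)) / 2
... | _ = ((q ∸ 3) * (q ∸ 7)) / 2

{-# OPTIONS --safe #-}
-- Write the residue ±(x+1) of ℤ_q as the signed level (±, x); for x < n with n + n < q these
-- residues are distinct and nonzero, and negation only flips the sign. Orient each pair of
-- distinct levels by a parity tournament (for x < y the arc goes up iff x + y has parity p).
-- A closed walk on signed levels whose arcs are pairwise distinct and all follow the
-- tournament is then a good SOS_q(2): equal windows are equal arcs, and a window equal to a
-- reversed (or negated reversed) window would traverse some pair of levels against its
-- orientation.
-- Such walks are built in stages: stage ℓ adds the levels ℓ+1 and ℓ+2 and runs through all
-- arcs joining them to the old levels 0, …, ℓ (and to each other when ℓ is even), once for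
-- each of the four sign patterns. Starting at ℓ = 1 with r stages for q = 6 + 4r, 7 + 4r,
-- and at ℓ = 0 with r + 1 stages for q = 8 + 4r, 9 + 4r, gives walks of the stated lengths.
module Submission where

open import Defs
open import Data.Empty using (⊥-elim)
open import Data.Fin as Fin using (Fin; zero; suc; toℕ; inject₁)
import Data.Fin.Properties as Fin
open import Data.List using (List; []; _∷_; _++_; length; lookup; concat)
open import Data.List.Properties using (length-++; ++-identityʳ)
open import Data.List.Relation.Unary.All as All using (All; []; _∷_)
import Data.List.Relation.Unary.All.Properties as All
open import Data.List.Relation.Unary.AllPairs using ([]; _∷_)
open import Data.List.Relation.Unary.Unique.Propositional using (Unique)
import Data.List.Relation.Unary.Unique.Propositional.Properties as Unique
open import Data.List.Relation.Binary.Disjoint.Propositional using (Disjoint)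
open import Data.Nat using (ℕ; zero; suc; _+_; _*_; _∸_; _≤_; _<_; z≤n; s≤s; NonZero; parity)
open import Data.Nat.Properties
open import Data.Nat.DivMod
  using (_%_; _/_; _mod_; _divMod_; result; m%n<n; m<n⇒m%n≡m; n%n≡0; m*n/n≡m; [m+kn]%n≡m%n)
open import Data.Nat.Tactic.RingSolver using (solve-∀)
open import Data.Parity.Base as ℙ using (Parity; 0ℙ; 1ℙ; _⁻¹)
import Data.Parity.Properties as ℙ
open import Data.Product using (Σ; ∃₂; _×_; _,_; proj₁; proj₂)
open import Data.Sign.Base as Sign using (Sign) renaming (+ to plus; - to minus)
import Data.Sign.Properties as Sign
open import Data.Sum using (_⊎_; inj₁; inj₂)
open import Data.Vec as Vec using (_∷_; [])
import Data.Vec.Properties as Vec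
open import Function using (_∘_)
open import Relation.Binary.Definitions using (Asymmetric)
open import Relation.Binary.PropositionalEquality
open import Relation.Nullary using (¬_)

-- The parity tournament

data ParityArc (p : Parity) (x y : ℕ) : Set where
  up   : x < y → parity x ℙ.+ parity y ≡ p → ParityArc p x y
  down : y < x → parity x ℙ.+ parity y ≡ p ⁻¹ → ParityArc p x y

ParityArc-asym : ∀ {p} → Asymmetric (ParityArc p)
ParityArc-asym (up x<y _)   (up y<x _)   = <-asym x<y y<x
ParityArc-asym (down y<x _) (down x<y _) = <-asym x<y y<x
ParityArc-asym {p} {x} {y} (up _ xy) (down _ yx) =
  ℙ.p≢p⁻¹ p (trans (sym xy) (trans (ℙ.+-comm (parity x) (parity y)) yx))
ParityArc-asym {p} {x} {y} (down _ xy) (up _ yx) =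
  ℙ.p≢p⁻¹ p (trans (sym yx) (trans (ℙ.+-comm (parity y) (parity x)) xy))

parity-suc : ∀ n → parity (suc n) ≡ parity n ⁻¹
parity-suc n = sym (ℙ.⁻¹-selfInverse (ℙ.suc-homo-⁻¹ n))

-- Signed levels in ℤ_q

SignedLevel : Set
SignedLevel = Sign × ℕ

level : SignedLevel → ℕ
level = proj₂

Arc : Set
Arc = SignedLevel × SignedLevel

Along : (ℕ → ℕ → Set) → Arc → Set
Along _⇝_ (u , v) = level u ⇝ level v

LevelsBelow : ℕ → Arc → Set
LevelsBelow n (u , v) = level u < n × level v < n

toℕ-negℤ : ∀ {q} (y : Fin q) → toℕ y ≢ 0 → toℕ (negℤ y) ≡ q ∸ toℕ y
toℕ-negℤ zero    y≢0 = ⊥-elim (y≢0 refl)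
toℕ-negℤ (suc i) _   = trans (Fin.opposite-prop (inject₁ i)) (cong (_ ∸_) (Fin.toℕ-inject₁ i))

negℤ-involutive : ∀ {q} (y : Fin q) → negℤ (negℤ y) ≡ y
negℤ-involutive zero            = refl
negℤ-involutive {suc q} (suc i) = Fin.toℕ-injective (begin
  toℕ (negℤ (negℤ (suc i)))   ≡⟨ toℕ-negℤ (negℤ (suc i)) -y≢0 ⟩
  suc q ∸ toℕ (negℤ (suc i))  ≡⟨ cong (suc q ∸_) toℕ-y ⟩
  suc q ∸ (q ∸ toℕ i)         ≡⟨ +-∸-assoc 1 (m∸n≤m q (toℕ i)) ⟩
  suc (q ∸ (q ∸ toℕ i))       ≡⟨ cong suc (m∸[m∸n]≡n (<⇒≤ (Fin.toℕ<n i))) ⟩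
  suc (toℕ i)                 ∎)
  where
  open ≡-Reasoning
  toℕ-y : toℕ (negℤ (suc i)) ≡ q ∸ toℕ i
  toℕ-y = toℕ-negℤ (suc i) (λ ())
  -y≢0 : toℕ (negℤ (suc i)) ≢ 0
  -y≢0 = <⇒≢ (m<n⇒0<n∸m (Fin.toℕ<n i)) ∘ sym ∘ trans (sym toℕ-y)

signed : ∀ {q} → Sign → Fin q → Fin q
signed plus  y = y
signed minus y = negℤ y

signed-* : ∀ {q} s t (y : Fin q) → signed s (signed t y) ≡ signed (s Sign.* t) y
signed-* plus  t     y = refl
signed-* minus plus  y = refl
signed-* minus minus y = negℤ-involutive y

encode : ∀ q .{{_ : NonZero q}} → SignedLevel → Fin q
encode q (s , x) = signed s (suc x mod q)

module _ {q n : ℕ} .{{_ : NonZero q}} (n+n<q : n + n < q) where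

  private
    1+x<q : ∀ {x} → x < n → suc x < q
    1+x<q x<n = ≤-<-trans x<n (≤-<-trans (m≤m+n n n) n+n<q)

    toℕ-1+x : ∀ {x} → x < n → toℕ (suc x mod q) ≡ suc x
    toℕ-1+x x<n = trans (Fin.toℕ-fromℕ< _) (m<n⇒m%n≡m (1+x<q x<n))

    toℕ-negated : ∀ {x} → x < n → toℕ (negℤ (suc x mod q)) ≡ q ∸ suc x
    toℕ-negated x<n = trans (toℕ-negℤ _ (λ eq → 0≢1+n (trans (sym eq) (toℕ-1+x x<n))))
                            (cong (q ∸_) (toℕ-1+x x<n))

    positive-injective : ∀ {x y} → x < n → y < n → suc x mod q ≡ suc y mod q → x ≡ y
    positive-injective x<n y<n eq =
      suc-injective (trans (sym (toℕ-1+x x<n)) (trans (cong toℕ eq) (toℕ-1+x y<n)))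

    positive≢negative : ∀ {x y} → x < n → y < n → suc x mod q ≢ negℤ (suc y mod q)
    positive≢negative {x} {y} x<n y<n eq = <-irrefl sum≡q (begin-strict
      suc x + suc y ≤⟨ +-mono-≤ x<n y<n ⟩
      n + n         <⟨ n+n<q ⟩
      q             ∎)
      where
      open ≤-Reasoning
      sum≡q : suc x + suc y ≡ q
      sum≡q = trans (cong (_+ suc y) (trans (sym (toℕ-1+x x<n)) (trans (cong toℕ eq) (toℕ-negated y<n))))
                    (m∸n+n≡m (<⇒≤ (1+x<q y<n)))

  encode-injective : ∀ u v → level u < n → level v < n → encode q u ≡ encode q v → u ≡ v
  encode-injective (plus  , _) (plus  , _) x<n y<n eq = cong (plus ,_) (positive-injective x<n y<n eq)
  encode-injective (minus , _) (minus , _) x<n y<n eq = cong (minus ,_) (positive-injective x<n y<n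
    (trans (sym (negℤ-involutive _)) (trans (cong negℤ eq) (negℤ-involutive _))))
  encode-injective (plus  , _) (minus , _) x<n y<n eq = ⊥-elim (positive≢negative x<n y<n eq)
  encode-injective (minus , _) (plus  , _) x<n y<n eq = ⊥-elim (positive≢negative y<n x<n (sym eq))

  encode-level : ∀ u v σ → level u < n → level v < n →
                 encode q u ≡ signed σ (encode q v) → level u ≡ level v
  encode-level u (t , y) σ x<n y<n eq =
    cong level (encode-injective u (σ Sign.* t , y) x<n y<n (trans eq (signed-* σ t (suc y mod q))))

  encode-nonzero : ∀ v → level v < n → toℕ (encode q v) ≢ 0
  encode-nonzero (plus  , x) x<n eq = 0≢1+n (trans (sym eq) (toℕ-1+x x<n))
  encode-nonzero (minus , x) x<n eq =
    <⇒≢ (m<n⇒0<n∸m (1+x<q x<n)) (sym (trans (sym (toℕ-negated x<n)) eq))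

-- Closed walks

module _ {A : Set} where

  lookupOr : List A → A → ℕ → A
  lookupOr []       d t       = d
  lookupOr (x ∷ xs) d zero    = x
  lookupOr (x ∷ xs) d (suc t) = lookupOr xs d t

  lookup≡lookupOr : ∀ xs d (i : Fin (length xs)) → lookup xs i ≡ lookupOr xs d (toℕ i)
  lookup≡lookupOr (x ∷ xs) d zero    = refl
  lookup≡lookupOr (x ∷ xs) d (suc i) = lookup≡lookupOr xs d i

  lookupOr-length : ∀ xs (d : A) → lookupOr xs d (length xs) ≡ d
  lookupOr-length []       d = refl
  lookupOr-length (x ∷ xs) d = lookupOr-length xs d

  All-lookupOr : ∀ {P : A → Set} {xs} d {t} → All P xs → t < length xs → P (lookupOr xs d t)
  All-lookupOr d {zero}  (px ∷ _)   _         = px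
  All-lookupOr d {suc t} (_  ∷ pxs) (s≤s t<n) = All-lookupOr d pxs t<n

  Unique-lookupOr-injective : ∀ {xs} d {t u} → Unique xs → t < length xs → u < length xs →
                              lookupOr xs d t ≡ lookupOr xs d u → t ≡ u
  Unique-lookupOr-injective d {zero}  {zero}  _            _         _         _  = refl
  Unique-lookupOr-injective d {zero}  {suc u} (x∉xs ∷ _)   _         (s≤s u<n) eq =
    ⊥-elim (All-lookupOr d x∉xs u<n eq)
  Unique-lookupOr-injective d {suc t} {zero}  (x∉xs ∷ _)   (s≤s t<n) _         eq =
    ⊥-elim (All-lookupOr d x∉xs t<n (sym eq))
  Unique-lookupOr-injective d {suc t} {suc u} (_ ∷ unique) (s≤s t<n) (s≤s u<n) eq =
    cong suc (Unique-lookupOr-injective d unique t<n u<n eq)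

module _ {A : Set} where

  arcsTo : List A → A → List (A × A)
  arcsTo []           v = []
  arcsTo (x ∷ [])     v = (x , v) ∷ []
  arcsTo (x ∷ y ∷ xs) v = (x , y) ∷ arcsTo (y ∷ xs) v

  closedArcs : List A → List (A × A)
  closedArcs []       = []
  closedArcs (v ∷ vs) = arcsTo (v ∷ vs) v

  arcsTo-++ : ∀ xs y ys (v : A) → arcsTo (xs ++ y ∷ ys) v ≡ arcsTo xs y ++ arcsTo (y ∷ ys) v
  arcsTo-++ []            y ys v = refl
  arcsTo-++ (x ∷ [])      y ys v = refl
  arcsTo-++ (x ∷ x′ ∷ xs) y ys v = cong ((x , x′) ∷_) (arcsTo-++ (x′ ∷ xs) y ys v)

  length-arcsTo : ∀ xs (v : A) → length (arcsTo xs v) ≡ length xs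
  length-arcsTo []           v = refl
  length-arcsTo (x ∷ [])     v = refl
  length-arcsTo (x ∷ y ∷ xs) v = cong suc (length-arcsTo (y ∷ xs) v)

  lookupOr-arcsTo : ∀ xs v {t} → t < length xs →
                    lookupOr (arcsTo xs v) (v , v) t ≡ (lookupOr xs v t , lookupOr xs v (suc t))
  lookupOr-arcsTo (x ∷ [])     v {zero}  _         = refl
  lookupOr-arcsTo (x ∷ [])     v {suc t} (s≤s ())
  lookupOr-arcsTo (x ∷ y ∷ xs) v {zero}  _         = refl
  lookupOr-arcsTo (x ∷ y ∷ xs) v {suc t} (s≤s t<n) = lookupOr-arcsTo (y ∷ xs) v t<n

  -- With default v, position length (v ∷ vs) is v again, as in the cyclic sequence.
  lookup-mod : ∀ (v : A) vs {u} → u ≤ length (v ∷ vs) →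
               lookup (v ∷ vs) (u mod length (v ∷ vs)) ≡ lookupOr (v ∷ vs) v u
  lookup-mod v vs {u} u≤m = trans (lookup≡lookupOr W v (u mod m))
                                  (trans (cong (lookupOr W v) (Fin.toℕ-fromℕ< (m%n<n u m)))
                                         (wrap (m≤n⇒m<n∨m≡n u≤m)))
    where
    W = v ∷ vs
    m = length W
    wrap : u < m ⊎ u ≡ m → lookupOr W v (u % m) ≡ lookupOr W v u
    wrap (inj₁ u<m) = cong (lookupOr W v) (m<n⇒m%n≡m u<m)
    wrap (inj₂ u≡m) = begin
      lookupOr W v (u % m) ≡⟨ cong (lookupOr W v) (trans (cong (_% m) u≡m) (n%n≡0 m)) ⟩
      v                    ≡⟨ sym (lookupOr-length W v) ⟩
      lookupOr W v m       ≡⟨ cong (lookupOr W v) (sym u≡m) ⟩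
      lookupOr W v u       ∎
      where open ≡-Reasoning

  at-closedArcs : ∀ (v : A) vs (i : Fin (length (v ∷ vs))) →
                  (at (lookup (v ∷ vs)) i 0 , at (lookup (v ∷ vs)) i 1)
                    ≡ lookupOr (closedArcs (v ∷ vs)) (v , v) (toℕ i)
  at-closedArcs v vs i = begin
    (at w i 0 , at w i 1)
      ≡⟨ cong₂ _,_ (lookup-mod v vs (subst (_≤ length W) (sym (+-identityʳ (toℕ i))) (<⇒≤ i<m)))
                   (lookup-mod v vs (subst (_≤ length W) (+-comm 1 (toℕ i)) i<m)) ⟩
    (lookupOr W v (toℕ i + 0) , lookupOr W v (toℕ i + 1))
      ≡⟨ cong₂ (λ a b → lookupOr W v a , lookupOr W v b) (+-identityʳ (toℕ i)) (+-comm (toℕ i) 1) ⟩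
    (lookupOr W v (toℕ i) , lookupOr W v (suc (toℕ i)))
      ≡⟨ sym (lookupOr-arcsTo W v i<m) ⟩
    lookupOr (arcsTo W v) (v , v) (toℕ i) ∎
    where
    open ≡-Reasoning
    W = v ∷ vs
    w = lookup W
    i<m : toℕ i < length W
    i<m = Fin.toℕ<n i

-- From closed walks to sequences

GoodSOS₂ : (q m : ℕ) → Set
GoodSOS₂ q m = Σ (Fin m → Fin q) (λ s → IsSOS q 2 s × IsGood q 2 s)

circuit⇒goodSOS : ∀ {q n} .{{_ : NonZero q}} → n + n < q →
                  ∀ {_⇝_ : ℕ → ℕ → Set} → Asymmetric _⇝_ → (W : List SignedLevel) →
                  Unique (closedArcs W) → All (Along _⇝_) (closedArcs W) →
                  All (LevelsBelow n) (closedArcs W) → GoodSOS₂ q (length W)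
circuit⇒goodSOS _ _ [] _ _ _ = (λ ()) , ((λ ()) , (λ ()) , (λ ())) , (λ ())
circuit⇒goodSOS {q} {n} n+n<q {_⇝_} asym (v ∷ vs) distinct along below =
  s , (window-injective , reversal plus , reversal minus) , nonzero
  where
  W = v ∷ vs
  w : Fin (length W) → SignedLevel
  w = lookup W
  s : Fin (length W) → Fin q
  s = encode q ∘ w
  arc : Fin (length W) → Arc
  arc i = at w i 0 , at w i 1
  index< : ∀ i → toℕ i < length (closedArcs W)
  index< i = subst (toℕ i <_) (sym (length-arcsTo W v)) (Fin.toℕ<n i)
  arc≡ : ∀ i → arc i ≡ lookupOr (closedArcs W) (v , v) (toℕ i)
  arc≡ = at-closedArcs v vs
  arc-injective : ∀ {i j} → arc i ≡ arc j → i ≡ j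
  arc-injective {i} {j} eq = Fin.toℕ-injective (Unique-lookupOr-injective (v , v) distinct
    (index< i) (index< j) (trans (sym (arc≡ i)) (trans eq (arc≡ j))))
  arc-along : ∀ i → Along _⇝_ (arc i)
  arc-along i = subst (Along _⇝_) (sym (arc≡ i)) (All-lookupOr (v , v) along (index< i))
  arc-below : ∀ i → LevelsBelow n (arc i)
  arc-below i = subst (LevelsBelow n) (sym (arc≡ i)) (All-lookupOr (v , v) below (index< i))
  below₀ : ∀ i → level (at w i 0) < n
  below₀ = proj₁ ∘ arc-below
  below₁ : ∀ i → level (at w i 1) < n
  below₁ = proj₂ ∘ arc-below
  second : ∀ {a b c d : Fin q} → a ∷ b ∷ [] ≡ c ∷ d ∷ [] → b ≡ d
  second = Vec.∷-injectiveˡ ∘ Vec.∷-injectiveʳ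
  window-injective : ∀ i j → window 2 s i ≡ window 2 s j → i ≡ j
  window-injective i j eq = arc-injective (cong₂ _,_
    (encode-injective n+n<q (at w i 0) (at w j 0) (below₀ i) (below₀ j) (Vec.∷-injectiveˡ eq))
    (encode-injective n+n<q (at w i 1) (at w j 1) (below₁ i) (below₁ j) (second eq)))
  -- map (signed plus) is the identity and map (signed minus) is map negℤ.
  reversal : ∀ σ i j → window 2 s i ≢ Vec.map (signed σ) (Vec.reverse (window 2 s j))
  reversal σ i j eq = asym (arc-along j) (subst₂ _⇝_
    (encode-level n+n<q (at w i 0) (at w j 1) σ (below₀ i) (below₁ j) (Vec.∷-injectiveˡ eq))
    (encode-level n+n<q (at w i 1) (at w j 0) σ (below₁ i) (below₀ j) (second eq))
    (arc-along i))
  nonzero : IsGood q 2 s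
  nonzero i all-zero = encode-nonzero n+n<q (at w i 0) (below₀ i) (all-zero zero)

-- Blocks, stages and walks

All⇒Disjoint : ∀ {A : Set} {P : A → Set} {xs ys} → All P xs → All (¬_ ∘ P) ys → Disjoint xs ys
All⇒Disjoint pxs ¬pys (x∈xs , x∈ys) = All.lookup ¬pys x∈ys (All.lookup pxs x∈xs)

Reaches : ℕ → Arc → Set
Reaches N (u , v) = N ≤ level u ⊎ N ≤ level v

Reaches⇒¬LevelsBelow : ∀ {N e} → Reaches N e → ¬ LevelsBelow N e
Reaches⇒¬LevelsBelow (inj₁ N≤u) (u<N , _) = <⇒≱ u<N N≤u
Reaches⇒¬LevelsBelow (inj₂ N≤v) (_ , v<N) = <⇒≱ v<N N≤v

Reaches-mono : ∀ {M N e} → M ≤ N → Reaches N e → Reaches M e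
Reaches-mono M≤N (inj₁ N≤u) = inj₁ (≤-trans M≤N N≤u)
Reaches-mono M≤N (inj₂ N≤v) = inj₂ (≤-trans M≤N N≤v)

LevelsBelow-mono : ∀ {M N e} → M ≤ N → LevelsBelow M e → LevelsBelow N e
LevelsBelow-mono M≤N (u<M , v<M) = <-≤-trans u<M M≤N , <-≤-trans v<M M≤N

-- The
-- signs α·β and −α are fields rather than indices so that arcs of different blocks can be
-- matched against each other.
data BlockArc (α β : Sign) (ℓ : ℕ) : Arc → Set where
  toA     : ∀ {k} → k ≤ ℓ → parity k ≡ 0ℙ → BlockArc α β ℓ ((α , k) , (β , suc ℓ))
  fromA   : ∀ {k} → k ≤ ℓ → parity k ≡ 1ℙ → BlockArc α β ℓ ((β , suc ℓ) , (α , k))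
  toB     : ∀ {k γ} → k ≤ ℓ → parity k ≡ 1ℙ → γ ≡ α Sign.* β →
            BlockArc α β ℓ ((α , k) , (γ , suc (suc ℓ)))
  fromB   : ∀ {k γ} → k < ℓ → parity k ≡ 1ℙ → γ ≡ α Sign.* β →
            BlockArc α β ℓ ((γ , suc (suc ℓ)) , (α , suc k))
  AtoB    : ∀ {γ} → parity ℓ ≡ 0ℙ → γ ≡ α Sign.* β →
            BlockArc α β ℓ ((β , suc ℓ) , (γ , suc (suc ℓ)))
  BtoHome : ∀ {γ δ} → γ ≡ α Sign.* β → δ ≡ Sign.opposite α →
            BlockArc α β ℓ ((γ , suc (suc ℓ)) , (δ , 0))

module _ {α β : Sign} {ℓ : ℕ} where

  BlockArc-oriented : ∀ {e} → BlockArc α β ℓ e → Along (ParityArc (parity (suc ℓ))) e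
  BlockArc-oriented (toA k≤ℓ k-even) = up (s≤s k≤ℓ) (cong (ℙ._+ parity (suc ℓ)) k-even)
  BlockArc-oriented (fromA k≤ℓ k-odd) =
    down (s≤s k≤ℓ) (trans (cong (parity (suc ℓ) ℙ.+_) k-odd) (ℙ.+-comm (parity (suc ℓ)) 1ℙ))
  BlockArc-oriented (toB k≤ℓ k-odd _) =
    up (s≤s (m≤n⇒m≤1+n k≤ℓ)) (trans (cong (ℙ._+ parity ℓ) k-odd) (sym (parity-suc ℓ)))
  BlockArc-oriented {(_ , _) , (_ , suc k)} (fromB k<ℓ k-odd _) =
    down (s≤s (m≤n⇒m≤1+n k<ℓ)) (begin
      parity ℓ ℙ.+ parity (suc k) ≡⟨ cong (parity ℓ ℙ.+_) (trans (parity-suc k) (cong _⁻¹ k-odd)) ⟩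
      parity ℓ ℙ.+ 0ℙ             ≡⟨ ℙ.+-identityʳ (parity ℓ) ⟩
      parity ℓ                    ≡⟨ sym (ℙ.suc-homo-⁻¹ ℓ) ⟩
      parity (suc ℓ) ⁻¹           ∎)
    where open ≡-Reasoning
  BlockArc-oriented (AtoB ℓ-even _) =
    up (n<1+n (suc ℓ)) (trans (cong (parity (suc ℓ) ℙ.+_) ℓ-even) (ℙ.+-identityʳ (parity (suc ℓ))))
  BlockArc-oriented (BtoHome _ _) =
    down (s≤s z≤n) (trans (ℙ.+-identityʳ (parity ℓ)) (sym (ℙ.suc-homo-⁻¹ ℓ)))

  BlockArc-below : ∀ {e} → BlockArc α β ℓ e → LevelsBelow (3 + ℓ) e
  BlockArc-below (toA k≤ℓ _)     = s≤s (m≤n⇒m≤1+n (m≤n⇒m≤1+n k≤ℓ)) , s≤s (n≤1+n (suc ℓ))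
  BlockArc-below (fromA k≤ℓ _)   = s≤s (n≤1+n (suc ℓ)) , s≤s (m≤n⇒m≤1+n (m≤n⇒m≤1+n k≤ℓ))
  BlockArc-below (toB k≤ℓ _ _)   = s≤s (m≤n⇒m≤1+n (m≤n⇒m≤1+n k≤ℓ)) , ≤-refl
  BlockArc-below (fromB k<ℓ _ _) = ≤-refl , s≤s (m≤n⇒m≤1+n (m≤n⇒m≤1+n k<ℓ))
  BlockArc-below (AtoB _ _)      = s≤s (n≤1+n (suc ℓ)) , ≤-refl
  BlockArc-below (BtoHome _ _)   = ≤-refl , s≤s z≤n

  BlockArc-reaches : ∀ {e} → BlockArc α β ℓ e → Reaches (suc ℓ) e
  BlockArc-reaches (toA _ _)     = inj₂ ≤-refl
  BlockArc-reaches (fromA _ _)   = inj₁ ≤-refl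
  BlockArc-reaches (toB _ _ _)   = inj₂ (n≤1+n (suc ℓ))
  BlockArc-reaches (fromB _ _ _) = inj₁ (n≤1+n (suc ℓ))
  BlockArc-reaches (AtoB _ _)    = inj₁ ≤-refl
  BlockArc-reaches (BtoHome _ _) = inj₁ (n≤1+n (suc ℓ))

BlockArc-signs : ∀ {α β α′ β′ ℓ e} → BlockArc α β ℓ e → BlockArc α′ β′ ℓ e →
                 (α , β) ≡ (α′ , β′)
BlockArc-signs (toA _ _)   (toA _ _)   = refl
BlockArc-signs (fromA _ _) (fromA _ _) = refl
BlockArc-signs {α} (toB _ _ refl) (toB _ _ γ≡)     = cong (α ,_) (Sign.*-cancelˡ-≡ α _ _ γ≡)
BlockArc-signs {α} (fromB _ _ refl) (fromB _ _ γ≡) = cong (α ,_) (Sign.*-cancelˡ-≡ α _ _ γ≡)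
BlockArc-signs {β = β} (AtoB _ refl) (AtoB _ γ≡)   = cong (_, β) (Sign.*-cancelʳ-≡ β _ _ γ≡)
BlockArc-signs {α} (BtoHome refl refl) (BtoHome γ≡ δ≡) with Sign.opposite-injective δ≡
... | refl = cong (α ,_) (Sign.*-cancelˡ-≡ α _ _ γ≡)
BlockArc-signs (toA k≤ℓ _) (fromA _ _)     = ⊥-elim (1+n≰n k≤ℓ)
BlockArc-signs (fromA _ _) (toA k≤ℓ _)     = ⊥-elim (1+n≰n k≤ℓ)
BlockArc-signs (toA k≤ℓ _) (fromB _ _ _)   = ⊥-elim (1+n≰n (≤-trans (n≤1+n _) k≤ℓ))
BlockArc-signs (fromB _ _ _) (toA k≤ℓ _)   = ⊥-elim (1+n≰n (≤-trans (n≤1+n _) k≤ℓ))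
BlockArc-signs (fromA k≤ℓ _) (toB _ _ _)   = ⊥-elim (1+n≰n (≤-trans (n≤1+n _) k≤ℓ))
BlockArc-signs (toB _ _ _) (fromA k≤ℓ _)   = ⊥-elim (1+n≰n (≤-trans (n≤1+n _) k≤ℓ))
BlockArc-signs (fromA k≤ℓ _) (AtoB _ _)    = ⊥-elim (1+n≰n (≤-trans (n≤1+n _) k≤ℓ))
BlockArc-signs (AtoB _ _) (fromA k≤ℓ _)    = ⊥-elim (1+n≰n (≤-trans (n≤1+n _) k≤ℓ))
BlockArc-signs (toB k≤ℓ _ _) (fromB _ _ _) = ⊥-elim (1+n≰n (≤-trans (n≤1+n _) k≤ℓ))
BlockArc-signs (fromB _ _ _) (toB k≤ℓ _ _) = ⊥-elim (1+n≰n (≤-trans (n≤1+n _) k≤ℓ))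
BlockArc-signs (toB k≤ℓ _ _) (AtoB _ _)    = ⊥-elim (1+n≰n k≤ℓ)
BlockArc-signs (AtoB _ _) (toB k≤ℓ _ _)    = ⊥-elim (1+n≰n k≤ℓ)

-- Since B has sign
-- α·β, the four blocks of a stage carry every sign pair on every pair of levels exactly once.
module Block (α β : Sign) (ℓ : ℕ) where

  A B home : SignedLevel
  A    = β , suc ℓ
  B    = α Sign.* β , suc (suc ℓ)
  home = Sign.opposite α , 0

  partner : Parity → SignedLevel
  partner 0ℙ = A
  partner 1ℙ = B

  finish : Parity → List SignedLevel
  finish 0ℙ = B ∷ []
  finish 1ℙ = []

  -- sweep k π c visits the old levels k, …, k + c, where π is the parity of k.
  sweep continue : ℕ → Parity → ℕ → List SignedLevel
  sweep k π c = (α , k) ∷ partner π ∷ continue k π c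
  continue k π zero    = finish π
  continue k π (suc c) = sweep (suc k) (π ⁻¹) c

  vertices : List SignedLevel
  vertices = sweep 0 0ℙ ℓ

  arcs : List Arc
  arcs = arcsTo vertices home

  private
    k≤ℓ : ∀ {k c} → k + c ≡ ℓ → k ≤ ℓ
    k≤ℓ {k} {c} refl = m≤m+n k c

    k<ℓ : ∀ {k c} → k + suc c ≡ ℓ → k < ℓ
    k<ℓ {k} refl = m<m+n k (s≤s z≤n)

    advance : ∀ {k c} → k + suc c ≡ ℓ → suc k + c ≡ ℓ
    advance {k} {c} eq = trans (sym (+-suc k c)) eq

    k<partner : ∀ {k c} π → k + suc c ≡ ℓ → k < level (partner π)
    k<partner 0ℙ eq = m<n⇒m<1+n (k<ℓ eq)
    k<partner 1ℙ eq = m<n⇒m<1+n (m<n⇒m<1+n (k<ℓ eq))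

    parity-next : ∀ k {π} → parity k ≡ π → parity (suc k) ≡ π ⁻¹
    parity-next k refl = parity-suc k

    sources≢ : ∀ {e e′ : Arc} → level (proj₁ e) ≢ level (proj₁ e′) → e ≢ e′
    sources≢ ne refl = ne refl

  sweep-shapes : ∀ k π c → k + c ≡ ℓ → parity k ≡ π →
                 All (BlockArc α β ℓ) (arcsTo (sweep k π c) home)
  sweep-shapes k 0ℙ zero    eq k-even = toA (k≤ℓ eq) k-even ∷ AtoB ℓ-even refl ∷ BtoHome refl refl ∷ []
    where ℓ-even = subst (λ m → parity m ≡ 0ℙ) (trans (sym (+-identityʳ k)) eq) k-even
  sweep-shapes k 1ℙ zero    eq k-odd  = toB (k≤ℓ eq) k-odd refl ∷ BtoHome refl refl ∷ []
  sweep-shapes k 0ℙ (suc c) eq k-even =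
    toA (k≤ℓ eq) k-even ∷ fromA (k<ℓ eq) (parity-next k k-even)
    ∷ sweep-shapes (suc k) 1ℙ c (advance eq) (parity-next k k-even)
  sweep-shapes k 1ℙ (suc c) eq k-odd  =
    toB (k≤ℓ eq) k-odd refl ∷ fromB (k<ℓ eq) k-odd refl
    ∷ sweep-shapes (suc k) 0ℙ c (advance eq) (parity-next k k-odd)

  Above : ℕ → Arc → Set
  Above k (u , v) = k ≤ level u × (k < level v ⊎ level v ≡ 0)

  sweep-above : ∀ k π c → k + c ≡ ℓ → All (Above k) (arcsTo (sweep k π c) home)
  sweep-above k 0ℙ zero    eq =
    (≤-refl , inj₁ k<A) ∷ (<⇒≤ k<A , inj₁ k<B) ∷ (<⇒≤ k<B , inj₂ refl) ∷ []
    where k<A = s≤s (k≤ℓ eq)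
          k<B = m<n⇒m<1+n k<A
  sweep-above k 1ℙ zero    eq = (≤-refl , inj₁ k<B) ∷ (<⇒≤ k<B , inj₂ refl) ∷ []
    where k<B = s≤s (m≤n⇒m≤1+n (k≤ℓ eq))
  sweep-above k π  (suc c) eq =
    (≤-refl , inj₁ (k<partner π eq)) ∷ (<⇒≤ (k<partner π eq) , inj₁ (n<1+n k))
    ∷ All.map (λ {e} → weaken {e}) (sweep-above (suc k) (π ⁻¹) c (advance {k} eq))
    where
    weaken : ∀ {e} → Above (suc k) e → Above k e
    weaken (k<u , inj₁ 1+k<v) = <⇒≤ k<u , inj₁ (<-trans (n<1+n k) 1+k<v)
    weaken (k<u , inj₂ v≡0)   = <⇒≤ k<u , inj₂ v≡0

  sweep-unique : ∀ k π c → k + c ≡ ℓ → Unique (arcsTo (sweep k π c) home)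
  sweep-unique k 0ℙ zero    eq =
    (sources≢ (<⇒≢ k<A) ∷ sources≢ (<⇒≢ k<B) ∷ []) ∷ (sources≢ (<⇒≢ (n<1+n (suc ℓ))) ∷ []) ∷ [] ∷ []
    where k<A = s≤s (k≤ℓ eq)
          k<B = m<n⇒m<1+n k<A
  sweep-unique k 1ℙ zero    eq = (sources≢ (<⇒≢ k<B) ∷ []) ∷ [] ∷ []
    where k<B = s≤s (m≤n⇒m≤1+n (k≤ℓ eq))
  sweep-unique k π  (suc c) eq =
    (sources≢ (<⇒≢ (k<partner π eq)) ∷ All.map (λ {e} → first≢ {e}) rest-above)
    ∷ All.map (λ {e} → second≢ {e}) rest-above
    ∷ sweep-unique (suc k) (π ⁻¹) c (advance {k} eq)
    where
    rest-above : All (Above (suc k)) (arcsTo (sweep (suc k) (π ⁻¹) c) home)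
    rest-above = sweep-above (suc k) (π ⁻¹) c (advance {k} eq)
    first≢ : ∀ {e} → Above (suc k) e → ((α , k) , partner π) ≢ e
    first≢ (k<u , _) = sources≢ (<⇒≢ k<u)
    second≢ : ∀ {e} → Above (suc k) e → (partner π , (α , suc k)) ≢ e
    second≢ (_ , inj₁ 1+k<v) refl = <-irrefl refl 1+k<v
    second≢ (_ , inj₂ ())    refl

  shapes : All (BlockArc α β ℓ) arcs
  shapes = sweep-shapes 0 0ℙ ℓ refl refl

  unique : Unique arcs
  unique = sweep-unique 0 0ℙ ℓ refl

blocks-disjoint : ∀ {α β α′ β′ ℓ} → (α , β) ≢ (α′ , β′) →
                  Disjoint (Block.arcs α β ℓ) (Block.arcs α′ β′ ℓ)
blocks-disjoint {α} {β} {α′} {β′} {ℓ} ne = All⇒Disjoint (Block.shapes α β ℓ)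
  (All.map (λ s′ s → ne (BlockArc-signs s s′)) (Block.shapes α′ β′ ℓ))

base : SignedLevel
base = minus , 0

-- Each block leaves for the first vertex of the next one, and the last one for base.
stage : ℕ → List SignedLevel
stage ℓ = Block.vertices minus minus ℓ ++ Block.vertices plus plus ℓ
       ++ Block.vertices minus plus ℓ ++ Block.vertices plus minus ℓ

stageArcs : ℕ → List (List Arc)
stageArcs ℓ = Block.arcs minus minus ℓ ∷ Block.arcs plus plus ℓ
            ∷ Block.arcs minus plus ℓ ∷ Block.arcs plus minus ℓ ∷ []

arcsTo-stage : ∀ ℓ → arcsTo (stage ℓ) base ≡ concat (stageArcs ℓ)
arcsTo-stage ℓ = begin
  arcsTo (V minus minus ++ V plus plus ++ V minus plus ++ V plus minus) base
    ≡⟨ arcsTo-++ (V minus minus) _ _ base ⟩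
  E minus minus ++ arcsTo (V plus plus ++ V minus plus ++ V plus minus) base
    ≡⟨ cong (E minus minus ++_) (arcsTo-++ (V plus plus) _ _ base) ⟩
  E minus minus ++ E plus plus ++ arcsTo (V minus plus ++ V plus minus) base
    ≡⟨ cong (λ es → E minus minus ++ E plus plus ++ es) (arcsTo-++ (V minus plus) _ _ base) ⟩
  E minus minus ++ E plus plus ++ E minus plus ++ E plus minus
    ≡⟨ cong (λ es → E minus minus ++ E plus plus ++ E minus plus ++ es) (sym (++-identityʳ _)) ⟩
  concat (stageArcs ℓ) ∎
  where
  open ≡-Reasoning
  V : Sign → Sign → List SignedLevel
  V α β = Block.vertices α β ℓ
  E : Sign → Sign → List Arc
  E α β = Block.arcs α β ℓ

StageArc : ℕ → Arc → Set
StageArc ℓ e = ∃₂ λ α β → BlockArc α β ℓ e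

stage-shapes : ∀ ℓ → All (StageArc ℓ) (arcsTo (stage ℓ) base)
stage-shapes ℓ = subst (All (StageArc ℓ)) (sym (arcsTo-stage ℓ)) (All.concat⁺
  (tag (Block.shapes minus minus ℓ) ∷ tag (Block.shapes plus plus ℓ)
  ∷ tag (Block.shapes minus plus ℓ) ∷ tag (Block.shapes plus minus ℓ) ∷ []))
  where
  tag : ∀ {α β es} → All (BlockArc α β ℓ) es → All (StageArc ℓ) es
  tag = All.map (λ s → _ , _ , s)

stage-unique : ∀ ℓ → Unique (arcsTo (stage ℓ) base)
stage-unique ℓ = subst Unique (sym (arcsTo-stage ℓ)) (Unique.concat⁺
  (Block.unique minus minus ℓ ∷ Block.unique plus plus ℓ
  ∷ Block.unique minus plus ℓ ∷ Block.unique plus minus ℓ ∷ [])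
  ((blocks-disjoint (λ ()) ∷ blocks-disjoint (λ ()) ∷ blocks-disjoint (λ ()) ∷ [])
  ∷ (blocks-disjoint (λ ()) ∷ blocks-disjoint (λ ()) ∷ [])
  ∷ (blocks-disjoint (λ ()) ∷ []) ∷ [] ∷ []))

walk : ℕ → ℕ → List SignedLevel
walk ℓ zero    = []
walk ℓ (suc c) = stage ℓ ++ walk (suc (suc ℓ)) c

closedArcs-walk : ∀ ℓ c → closedArcs (walk ℓ (suc c))
                          ≡ arcsTo (stage ℓ) base ++ closedArcs (walk (suc (suc ℓ)) c)
closedArcs-walk ℓ zero    =
  trans (cong (λ vs → arcsTo vs base) (++-identityʳ (stage ℓ))) (sym (++-identityʳ _))
closedArcs-walk ℓ (suc c) = arcsTo-++ (stage ℓ) _ _ base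

walk-oriented : ∀ ℓ c → All (Along (ParityArc (parity (suc ℓ)))) (closedArcs (walk ℓ c))
walk-oriented ℓ zero    = []
walk-oriented ℓ (suc c) rewrite closedArcs-walk ℓ c =
  All.++⁺ (All.map (λ (_ , _ , s) → BlockArc-oriented s) (stage-shapes ℓ))
          (walk-oriented (suc (suc ℓ)) c)

walk-reaches : ∀ ℓ c → All (Reaches (suc ℓ)) (closedArcs (walk ℓ c))
walk-reaches ℓ zero    = []
walk-reaches ℓ (suc c) rewrite closedArcs-walk ℓ c =
  All.++⁺ (All.map (λ (_ , _ , s) → BlockArc-reaches s) (stage-shapes ℓ))
          (All.map (λ {e} → Reaches-mono {e = e} (m≤n⇒m≤1+n (n≤1+n (suc ℓ))))
                   (walk-reaches (suc (suc ℓ)) c))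

walk-below : ∀ ℓ c {N} → ℓ + c * 2 < N → All (LevelsBelow N) (closedArcs (walk ℓ c))
walk-below ℓ zero    _ = []
walk-below ℓ (suc c) {N} bound rewrite closedArcs-walk ℓ c =
  All.++⁺ (All.map (λ {e} (_ , _ , s) → LevelsBelow-mono {e = e} 3+ℓ≤N (BlockArc-below s))
                   (stage-shapes ℓ))
          (walk-below (suc (suc ℓ)) c bound′)
  where
  bound′ : suc (suc ℓ) + c * 2 < N
  bound′ = subst (_< N) (trans (+-suc ℓ (suc (c * 2))) (cong suc (+-suc ℓ (c * 2)))) bound
  3+ℓ≤N : 3 + ℓ ≤ N
  3+ℓ≤N = ≤-trans (s≤s (s≤s (s≤s (m≤m+n ℓ (c * 2))))) bound′

walk-unique : ∀ ℓ c → Unique (closedArcs (walk ℓ c))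
walk-unique ℓ zero    = []
walk-unique ℓ (suc c) rewrite closedArcs-walk ℓ c =
  Unique.++⁺ (stage-unique ℓ) (walk-unique (suc (suc ℓ)) c)
    (All⇒Disjoint (All.map (λ (_ , _ , s) → BlockArc-below s) (stage-shapes ℓ))
                  (All.map (λ {e} → Reaches⇒¬LevelsBelow {e = e}) (walk-reaches (suc (suc ℓ)) c)))

-- Lengths and periods

length-sweep[h*2+1] : ∀ α β ℓ k h → length (Block.sweep α β ℓ k 0ℙ (h * 2 + 1)) ≡ 4 + h * 4
length-sweep[h*2+1] α β ℓ k zero    = refl
length-sweep[h*2+1] α β ℓ k (suc h) = cong (4 +_) (length-sweep[h*2+1] α β ℓ (2 + k) h)

length-sweep[h*2+0] : ∀ α β ℓ k h → length (Block.sweep α β ℓ k 0ℙ (h * 2 + 0)) ≡ 3 + h * 4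
length-sweep[h*2+0] α β ℓ k zero    = refl
length-sweep[h*2+0] α β ℓ k (suc h) = cong (4 +_) (length-sweep[h*2+0] α β ℓ (2 + k) h)

length-stage : ∀ ℓ {m} → (∀ α β → length (Block.vertices α β ℓ) ≡ m) →
               length (stage ℓ) ≡ m + (m + (m + m))
length-stage ℓ len =
  trans (length-++ (Block.vertices minus minus ℓ)) (cong₂ _+_ (len minus minus)
  (trans (length-++ (Block.vertices plus plus ℓ)) (cong₂ _+_ (len plus plus)
  (trans (length-++ (Block.vertices minus plus ℓ)) (cong₂ _+_ (len minus plus) (len plus minus))))))

length-walk : ∀ ℓ d → (∀ j α β → length (Block.vertices α β (j * 2 + ℓ)) ≡ 2 + d + j * 4) →
              ∀ j c → length (walk (j * 2 + ℓ) c) ≡ c * (4 * d + 16 * j + 8 * c)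
length-walk ℓ d len j zero    = refl
length-walk ℓ d len j (suc c) = begin
  length (stage (j * 2 + ℓ) ++ walk (suc j * 2 + ℓ) c)
    ≡⟨ length-++ (stage (j * 2 + ℓ)) ⟩
  length (stage (j * 2 + ℓ)) + length (walk (suc j * 2 + ℓ) c)
    ≡⟨ cong₂ _+_ (length-stage (j * 2 + ℓ) (len j)) (length-walk ℓ d len (suc j) c) ⟩
  m + (m + (m + m)) + c * (4 * d + 16 * suc j + 8 * c)
    ≡⟨ arith d j c ⟩
  suc c * (4 * d + 16 * j + 8 * suc c) ∎
  where
  open ≡-Reasoning
  m : ℕ
  m = 2 + d + j * 4
  arith : ∀ d j c → let m = 2 + d + j * 4 in
          m + (m + (m + m)) + c * (4 * d + 16 * (1 + j) + 8 * c)
            ≡ (1 + c) * (4 * d + 16 * j + 8 * (1 + c))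
  arith = solve-∀

sosPeriod[0] : ∀ q → q % 4 ≡ 0 → sosPeriod q ≡ ((q ∸ 2) * (q ∸ 4)) / 2
sosPeriod[0] q q%4≡0 with q % 4 | q%4≡0
... | .0 | refl = refl

sosPeriod[1] : ∀ q → q % 4 ≡ 1 → sosPeriod q ≡ ((q ∸ 3) * (q ∸ 5)) / 2
sosPeriod[1] q q%4≡1 with q % 4 | q%4≡1
... | .1 | refl = refl

sosPeriod[2] : ∀ q → q % 4 ≡ 2 → sosPeriod q ≡ ((q ∸ 2) * (q ∸ 6)) / 2
sosPeriod[2] q q%4≡2 with q % 4 | q%4≡2
... | .2 | refl = refl

sosPeriod[3] : ∀ q → q % 4 ≡ 3 → sosPeriod q ≡ ((q ∸ 3) * (q ∸ 7)) / 2
sosPeriod[3] q q%4≡3 with q % 4 | q%4≡3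
... | .3 | refl = refl

halve : ∀ {m n} → n ≡ m * 2 → m ≡ n / 2
halve {m} refl = sym (m*n/n≡m m 2)

length-walk[1] : ∀ r → length (walk 1 r) ≡ ((4 + r * 4) * (r * 4)) / 2
length-walk[1] r =
  trans (length-walk 1 2 (λ j α β → length-sweep[h*2+1] α β _ 0 j) 0 r) (halve (arith r))
  where
  arith : ∀ r → (4 + r * 4) * (r * 4) ≡ r * (4 * 2 + 16 * 0 + 8 * r) * 2
  arith = solve-∀

length-walk[0] : ∀ r → length (walk 0 (suc r)) ≡ ((6 + r * 4) * (4 + r * 4)) / 2
length-walk[0] r =
  trans (length-walk 0 1 (λ j α β → length-sweep[h*2+0] α β _ 0 j) 0 (suc r)) (halve (arith r))
  where
  arith : ∀ r → (6 + r * 4) * (4 + r * 4) ≡ (1 + r) * (4 * 1 + 16 * 0 + 8 * (1 + r)) * 2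
  arith = solve-∀

levels-fit : ∀ a r d → (a + r * 2) + (a + r * 2) < suc (d + (a + a + r * 4))
levels-fit a r d = s≤s (≤-trans (≤-reflexive (arith a r)) (m≤n+m _ d))
  where
  arith : ∀ a r → (a + r * 2) + (a + r * 2) ≡ a + a + r * 4
  arith = solve-∀

walk-goodSOS : ∀ {q m} .{{_ : NonZero q}} ℓ c → suc (ℓ + c * 2) + suc (ℓ + c * 2) < q →
               length (walk ℓ c) ≡ m → GoodSOS₂ q m
walk-goodSOS ℓ c n+n<q refl = circuit⇒goodSOS n+n<q ParityArc-asym (walk ℓ c)
  (walk-unique ℓ c) (walk-oriented ℓ c) (walk-below ℓ c ≤-refl)

corollary4p7 : (q : ℕ) → 6 ≤ q →
    Σ (Fin (sosPeriod q) → Fin q) (λ s → IsSOS q 2 s × IsGood q 2 s)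
corollary4p7 q 6≤q with m≤n⇒∃[o]m+o≡n 6≤q
... | t , refl with t divMod 4
... | result r zero refl = walk-goodSOS 1 r (levels-fit 2 r 1)
  (trans (length-walk[1] r) (sym (sosPeriod[2] (6 + r * 4) ([m+kn]%n≡m%n 6 r 4))))
... | result r (suc zero) refl = walk-goodSOS 1 r (levels-fit 2 r 2)
  (trans (length-walk[1] r) (sym (sosPeriod[3] (7 + r * 4) ([m+kn]%n≡m%n 7 r 4))))
... | result r (suc (suc zero)) refl = walk-goodSOS 0 (suc r) (levels-fit 3 r 1)
  (trans (length-walk[0] r) (sym (sosPeriod[0] (8 + r * 4) ([m+kn]%n≡m%n 8 r 4))))
... | result r (suc (suc (suc zero))) refl = walk-goodSOS 0 (suc r) (levels-fit 3 r 2)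
  (trans (length-walk[0] r) (sym (sosPeriod[1] (9 + r * 4) ([m+kn]%n≡m%n 9 r 4))))
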